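{- Let $N, r, m, d, P, H$ be positive integers such that $r \leq \log_2 N$, $m \leq d/r$, $H < P \leq N^{1/r}$, and \[ H^{(d-1)/2} < \frac{1}{d^{1/2}\, 2^{(d-1)/4}} \cdot \frac{(P-H)^{rm}}{N^{rm(m+1)/2d}}. \] Define $f_0,\ldots,f_{d-1}\in\mathbb{Z}[x]$ by $f_i(x) = N^{m-\lfloor i/r\rfloor}(P+x)^i$ for $0 \leq i < rm$ and $f_i(x) = (P+x)^i$ for $rm \leq i < d$. Let $h(x) = h_0 + h_1x + \cdots + h_{d-1}x^{d-1}$ be a nonzero polynomial in the $\mathbb{Z}$-span of $f_0,\ldots,f_{d-1}$ satisfying \[ |h_0| + |h_1| H + \cdots + |h_{d-1}| H^{d-1} < d^{1/2}\, 2^{(d-1)/4} H^{(d-1)/2} N^{rm(m+1)/2d}. \] If $p$ is an integer with $P-H \leq p \leq P+H$ and $p^r \mid N$, then $x_0 = p - P$ is a root of $h(x)$. -}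

module Defs where

open import Data.Nat as ℕ using (ℕ; zero; suc; NonZero; _∸_)
open import Data.Nat.DivMod using (_/_)
open import Data.Integer as ℤ using (ℤ; +_)
open import Data.List using (List; []; _∷_; map; foldr; tabulate)
open import Data.Fin using (Fin; toℕ)
open import Data.Bool using (if_then_else_)
open import Relation.Nullary.Decidable using (⌊_⌋)
open import Relation.Binary.PropositionalEquality using (_≡_)
open import Data.Product using (Σ)

-- Integer polynomials as coefficient lists, constant term first.
Poly : Set
Poly = List ℤ

infixl 6 _+ₚ_
infixl 7 _*ₚ_ _·ₚ_
infixr 8 _^ₚ_

_+ₚ_ : Poly → Poly → Poly
[] +ₚ q = q
(a ∷ p) +ₚ [] = a ∷ p
(a ∷ p) +ₚ (b ∷ q) = (a ℤ.+ b) ∷ (p +ₚ q)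

_·ₚ_ : ℤ → Poly → Poly
c ·ₚ p = map (c ℤ.*_) p

_*ₚ_ : Poly → Poly → Poly
[] *ₚ q = []
(a ∷ p) *ₚ q = (a ·ₚ q) +ₚ (+ 0 ∷ (p *ₚ q))

_^ₚ_ : Poly → ℕ → Poly
p ^ₚ zero = + 1 ∷ []
p ^ₚ suc n = p *ₚ (p ^ₚ n)

X : Poly
X = + 0 ∷ + 1 ∷ []

constₚ : ℤ → Poly
constₚ c = c ∷ []

coeff : Poly → ℕ → ℤ
coeff [] _ = + 0
coeff (a ∷ p) zero = a
coeff (a ∷ p) (suc j) = coeff p j

eval : Poly → ℤ → ℤ
eval [] x = + 0
eval (a ∷ p) x = a ℤ.+ x ℤ.* eval p x

fromCoeffs : (d : ℕ) → (Fin d → ℤ) → Poly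
fromCoeffs d h = tabulate h

fpoly : (N r m P : ℕ) → .{{_ : NonZero r}} → ℕ → Poly
fpoly N r m P i =
  if ⌊ i ℕ.<? r ℕ.* m ⌋
  then (+ (N ℕ.^ (m ∸ (i / r)))) ·ₚ ((constₚ (+ P) +ₚ X) ^ₚ i)
  else (constₚ (+ P) +ₚ X) ^ₚ i

linComb : (d : ℕ) → (Fin d → ℤ) → (ℕ → Poly) → Poly
linComb d c f = foldr _+ₚ_ [] (tabulate (λ i → c i ·ₚ f (toℕ i)))

InSpan : (d : ℕ) → (ℕ → Poly) → Poly → Set
InSpan d f h = Σ (Fin d → ℤ) λ c → ∀ j → coeff h j ≡ coeff (linComb d c f) j

-- Each f_i takes at x₀ = p − P a value divisible by p^{rm}: (P + x₀)^i = p^i, and for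
-- i < rm the factor N^{m−⌊i/r⌋} supplies the missing (p^r)^{m−⌊i/r⌋}. Hence p^{rm} ∣ h(x₀).
-- Since |x₀| ≤ H, |h(x₀)| is at most the weighted coefficient sum, which the two size
-- hypotheses push below (P − H)^{rm} ≤ p^{rm}; a multiple of p^{rm} that small is 0.
module Submission where

open import Defs
open import Data.Nat as ℕ using (ℕ; NonZero; _≤_; _<_; _∸_; _^_; _*_)
open import Data.Integer as ℤ using (ℤ; +_; ∣_∣)
open import Data.Integer.Divisibility using (_∣_)
open import Data.List using (tabulate)
open import Data.Nat.ListAction using (sum)
open import Data.Fin using (Fin; toℕ)
open import Relation.Binary.PropositionalEquality using (_≡_)
open import Relation.Nullary using (¬_)

open import Data.Fin using (zero; suc)
open import Data.Integer.Divisibility.Signed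
  using (∣ᵤ⇒∣; ∣⇒∣ᵤ; ∣-refl; ∣m∣n⇒∣m+n; ∣n⇒∣m*n; ∣m⇒∣m*n; *-monoˡ-∣; *-monoʳ-∣; module ∣-Reasoning)
  renaming (_∣_ to _∣ₛ_)
open import Data.Integer.Tactic.RingSolver using (solve-∀)
import Data.Integer.Properties as ℤ
open import Data.List using ([]; _∷_; map)
open import Data.List.Properties using (map-tabulate; tabulate-cong)
import Data.Nat.Divisibility as ℕ
open import Data.Nat.DivMod using (_/_; m/n*n≤m)
import Data.Nat.Properties as ℕ
open import Algebra.Properties.CommutativeSemigroup ℕ.*-commutativeSemigroup using (x∙yz≈y∙xz)
open import Function using (_∘_)
import Data.Nat.Tactic.RingSolver as ℕ-Solver
open import Data.Product using (_,_)
open import Relation.Binary.PropositionalEquality using (refl; sym; trans; cong; cong₂; subst; module ≡-Reasoning)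
open import Relation.Nullary using (yes; no; contradiction)

eval-+ₚ : ∀ p q x → eval (p +ₚ q) x ≡ eval p x ℤ.+ eval q x
eval-+ₚ []      q       x = sym (ℤ.+-identityˡ _)
eval-+ₚ (a ∷ p) []      x = sym (ℤ.+-identityʳ _)
eval-+ₚ (a ∷ p) (b ∷ q) x = begin
  a ℤ.+ b ℤ.+ x ℤ.* eval (p +ₚ q) x             ≡⟨ cong (λ t → a ℤ.+ b ℤ.+ x ℤ.* t) (eval-+ₚ p q x) ⟩
  a ℤ.+ b ℤ.+ x ℤ.* (eval p x ℤ.+ eval q x)     ≡⟨ regroup a b x (eval p x) (eval q x) ⟩
  a ℤ.+ x ℤ.* eval p x ℤ.+ (b ℤ.+ x ℤ.* eval q x) ∎
  where
  open ≡-Reasoning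
  regroup : ∀ a b x u v → a ℤ.+ b ℤ.+ x ℤ.* (u ℤ.+ v) ≡ a ℤ.+ x ℤ.* u ℤ.+ (b ℤ.+ x ℤ.* v)
  regroup = solve-∀

eval-·ₚ : ∀ c p x → eval (c ·ₚ p) x ≡ c ℤ.* eval p x
eval-·ₚ c []      x = sym (ℤ.*-zeroʳ c)
eval-·ₚ c (a ∷ p) x = begin
  c ℤ.* a ℤ.+ x ℤ.* eval (c ·ₚ p) x   ≡⟨ cong (λ t → c ℤ.* a ℤ.+ x ℤ.* t) (eval-·ₚ c p x) ⟩
  c ℤ.* a ℤ.+ x ℤ.* (c ℤ.* eval p x) ≡⟨ regroup c a x (eval p x) ⟩
  c ℤ.* (a ℤ.+ x ℤ.* eval p x)       ∎
  where
  open ≡-Reasoning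
  regroup : ∀ c a x u → c ℤ.* a ℤ.+ x ℤ.* (c ℤ.* u) ≡ c ℤ.* (a ℤ.+ x ℤ.* u)
  regroup = solve-∀

eval-*ₚ : ∀ p q x → eval (p *ₚ q) x ≡ eval p x ℤ.* eval q x
eval-*ₚ []      q x = sym (ℤ.*-zeroˡ (eval q x))
eval-*ₚ (a ∷ p) q x = begin
  eval (a ·ₚ q +ₚ (+ 0 ∷ p *ₚ q)) x                  ≡⟨ eval-+ₚ (a ·ₚ q) (+ 0 ∷ p *ₚ q) x ⟩
  eval (a ·ₚ q) x ℤ.+ (+ 0 ℤ.+ x ℤ.* eval (p *ₚ q) x) ≡⟨ cong₂ (λ u v → u ℤ.+ (+ 0 ℤ.+ x ℤ.* v)) (eval-·ₚ a q x) (eval-*ₚ p q x) ⟩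
  a ℤ.* eval q x ℤ.+ (+ 0 ℤ.+ x ℤ.* (eval p x ℤ.* eval q x)) ≡⟨ regroup a x (eval p x) (eval q x) ⟩
  (a ℤ.+ x ℤ.* eval p x) ℤ.* eval q x                 ∎
  where
  open ≡-Reasoning
  regroup : ∀ a x u v → a ℤ.* v ℤ.+ (+ 0 ℤ.+ x ℤ.* (u ℤ.* v)) ≡ (a ℤ.+ x ℤ.* u) ℤ.* v
  regroup = solve-∀

eval-^ₚ : ∀ p n x → eval (p ^ₚ n) x ≡ eval p x ℤ.^ n
eval-^ₚ p ℕ.zero    x = cong (λ t → + 1 ℤ.+ t) (ℤ.*-zeroʳ x)
eval-^ₚ p (ℕ.suc n) x = trans (eval-*ₚ p (p ^ₚ n) x) (cong (eval p x ℤ.*_) (eval-^ₚ p n x))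

eval-shift-^ₚ : ∀ a b i → eval ((constₚ a +ₚ X) ^ₚ i) (b ℤ.- a) ≡ b ℤ.^ i
eval-shift-^ₚ a b i = trans (eval-^ₚ (constₚ a +ₚ X) i (b ℤ.- a)) (cong (ℤ._^ i) (shift a b))
  where
  shift : ∀ a b → a ℤ.+ + 0 ℤ.+ (b ℤ.- a) ℤ.* (+ 1 ℤ.+ (b ℤ.- a) ℤ.* + 0) ≡ b
  shift = solve-∀

eval-coeff-zero : ∀ p x → (∀ j → coeff p j ≡ + 0) → eval p x ≡ + 0
eval-coeff-zero []      x p≡0 = refl
eval-coeff-zero (a ∷ p) x p≡0 =
  trans (cong₂ (λ u v → u ℤ.+ x ℤ.* v) (p≡0 0) (eval-coeff-zero p x (p≡0 ∘ ℕ.suc)))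
        (trans (ℤ.+-identityˡ _) (ℤ.*-zeroʳ x))

eval-coeff-cong : ∀ p q x → (∀ j → coeff p j ≡ coeff q j) → eval p x ≡ eval q x
eval-coeff-cong []      q       x p≡q = sym (eval-coeff-zero q x (sym ∘ p≡q))
eval-coeff-cong (a ∷ p) []      x p≡q = eval-coeff-zero (a ∷ p) x p≡q
eval-coeff-cong (a ∷ p) (b ∷ q) x p≡q =
  cong₂ (λ u v → u ℤ.+ x ℤ.* v) (p≡q 0) (eval-coeff-cong p q x (λ j → p≡q (ℕ.suc j)))

∣-eval-linComb : ∀ {k x} d (c : Fin d → ℤ) (f : ℕ → Poly) →
  (∀ (i : Fin d) → k ∣ₛ eval (f (toℕ i)) x) → k ∣ₛ eval (linComb d c f) x
∣-eval-linComb ℕ.zero    c f k∣f = ∣ᵤ⇒∣ (ℕ._∣0 _)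
∣-eval-linComb {k} {x} (ℕ.suc d) c f k∣f =
  subst (k ∣ₛ_) (sym (eval-+ₚ (c zero ·ₚ f 0) (linComb d (λ i → c (suc i)) (λ i → f (ℕ.suc i))) x))
    (∣m∣n⇒∣m+n
      (subst (k ∣ₛ_) (sym (eval-·ₚ (c zero) (f 0) x)) (∣n⇒∣m*n (c zero) (k∣f zero)))
      (∣-eval-linComb d (λ i → c (suc i)) (λ i → f (ℕ.suc i)) (λ i → k∣f (suc i))))

∣-eval-InSpan : ∀ {k x} d (f : ℕ → Poly) (g : Poly) →
  (∀ i → k ∣ₛ eval (f i) x) → InSpan d f g → k ∣ₛ eval g x
∣-eval-InSpan {k} {x} d f g k∣f (c , g≡Σcf) =
  subst (k ∣ₛ_) (sym (eval-coeff-cong g (linComb d c f) x g≡Σcf))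
    (∣-eval-linComb d c f (k∣f ∘ toℕ))

pos-^ : ∀ m n → + (m ^ n) ≡ (+ m) ℤ.^ n
pos-^ m ℕ.zero    = refl
pos-^ m (ℕ.suc n) = trans (ℤ.pos-* m (m ^ n)) (cong (+ m ℤ.*_) (pos-^ m n))

^-monoʳ-∣ : ∀ i {m n} → m ≤ n → i ℤ.^ m ∣ₛ i ℤ.^ n
^-monoʳ-∣ i {m} {n} m≤n = begin
  i ℤ.^ m                   ∣⟨ ∣m⇒∣m*n (i ℤ.^ (n ∸ m)) ∣-refl ⟩
  i ℤ.^ m ℤ.* i ℤ.^ (n ∸ m) ≡⟨ ℤ.^-distribˡ-+-* i m (n ∸ m) ⟨
  i ℤ.^ (m ℕ.+ (n ∸ m))     ≡⟨ cong (i ℤ.^_) (ℕ.m+[n∸m]≡n m≤n) ⟩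
  i ℤ.^ n                   ∎
  where open ∣-Reasoning

^-monoˡ-∣ : ∀ n {i j} → i ∣ₛ j → i ℤ.^ n ∣ₛ j ℤ.^ n
^-monoˡ-∣ ℕ.zero    i∣j = ∣-refl
^-monoˡ-∣ (ℕ.suc n) {i} {j} i∣j = begin
  i ℤ.* i ℤ.^ n ∣⟨ *-monoˡ-∣ (i ℤ.^ n) i∣j ⟩
  j ℤ.* i ℤ.^ n ∣⟨ *-monoʳ-∣ j (^-monoˡ-∣ n i∣j) ⟩
  j ℤ.* j ℤ.^ n ∎
  where open ∣-Reasoning

r*m≤i+r*[m∸i/r] : ∀ r m i .{{_ : NonZero r}} → r * m ≤ i ℕ.+ r * (m ∸ i / r)
r*m≤i+r*[m∸i/r] r m i = begin
  r * m                           ≤⟨ ℕ.*-monoʳ-≤ r (ℕ.m≤n+m∸n m (i / r)) ⟩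
  r * (i / r ℕ.+ (m ∸ i / r))     ≡⟨ ℕ.*-distribˡ-+ r (i / r) (m ∸ i / r) ⟩
  r * (i / r) ℕ.+ r * (m ∸ i / r) ≤⟨ ℕ.+-monoˡ-≤ (r * (m ∸ i / r)) r*[i/r]≤i ⟩
  i ℕ.+ r * (m ∸ i / r)           ∎
  where
  open ℕ.≤-Reasoning
  r*[i/r]≤i : r * (i / r) ≤ i
  r*[i/r]≤i = subst (_≤ i) (ℕ.*-comm (i / r) r) (m/n*n≤m i r)

^-∣-eval-fpoly : ∀ N r m P i .{{_ : NonZero r}} (p : ℤ) →
  p ℤ.^ r ∣ₛ + N → p ℤ.^ (r * m) ∣ₛ eval (fpoly N r m P i) (p ℤ.- + P)
^-∣-eval-fpoly N r m P i p pʳ∣N with i ℕ.<? r * m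
... | yes i<rm = begin
  p ℤ.^ (r * m)                ∣⟨ ^-monoʳ-∣ p (r*m≤i+r*[m∸i/r] r m i) ⟩
  p ℤ.^ (i ℕ.+ r * e)          ≡⟨ ℤ.^-distribˡ-+-* p i (r * e) ⟩
  p ℤ.^ i ℤ.* p ℤ.^ (r * e)    ≡⟨ cong (p ℤ.^ i ℤ.*_) (ℤ.^-*-assoc p r e) ⟨
  p ℤ.^ i ℤ.* (p ℤ.^ r) ℤ.^ e  ∣⟨ *-monoʳ-∣ (p ℤ.^ i) (^-monoˡ-∣ e pʳ∣N) ⟩
  p ℤ.^ i ℤ.* (+ N) ℤ.^ e      ≡⟨ cong (p ℤ.^ i ℤ.*_) (pos-^ N e) ⟨
  p ℤ.^ i ℤ.* + (N ^ e)        ≡⟨ ℤ.*-comm (p ℤ.^ i) (+ (N ^ e)) ⟩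
  + (N ^ e) ℤ.* p ℤ.^ i        ≡⟨ cong (+ (N ^ e) ℤ.*_) (eval-shift-^ₚ (+ P) p i) ⟨
  + (N ^ e) ℤ.* eval Pxⁱ x₀    ≡⟨ eval-·ₚ (+ (N ^ e)) Pxⁱ x₀ ⟨
  eval (+ (N ^ e) ·ₚ Pxⁱ) x₀   ∎
  where
  open ∣-Reasoning
  e : ℕ
  e = m ∸ i / r
  x₀ : ℤ
  x₀ = p ℤ.- + P
  Pxⁱ : Poly
  Pxⁱ = (constₚ (+ P) +ₚ X) ^ₚ i
... | no i≮rm = begin
  p ℤ.^ (r * m)                                ∣⟨ ^-monoʳ-∣ p (ℕ.≮⇒≥ i≮rm) ⟩
  p ℤ.^ i                                      ≡⟨ eval-shift-^ₚ (+ P) p i ⟨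
  eval ((constₚ (+ P) +ₚ X) ^ₚ i) (p ℤ.- + P)  ∎
  where open ∣-Reasoning

*-distribˡ-sum : ∀ k ns → k * sum ns ≡ sum (map (k *_) ns)
*-distribˡ-sum k []       = ℕ.*-zeroʳ k
*-distribˡ-sum k (n ∷ ns) = trans (ℕ.*-distribˡ-+ k n (sum ns)) (cong (k * n ℕ.+_) (*-distribˡ-sum k ns))

∣eval-tabulate∣≤ : ∀ {H x} d (h : Fin d → ℤ) → ∣ x ∣ ≤ H →
  ∣ eval (tabulate h) x ∣ ≤ sum (tabulate (λ j → ∣ h j ∣ * H ^ toℕ j))
∣eval-tabulate∣≤ ℕ.zero h ∣x∣≤H = ℕ.z≤n
∣eval-tabulate∣≤ {H} {x} (ℕ.suc d) h ∣x∣≤H = begin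
  ∣ h zero ℤ.+ x ℤ.* eval (tabulate tail) x ∣   ≤⟨ ℤ.∣i+j∣≤∣i∣+∣j∣ (h zero) _ ⟩
  ∣ h zero ∣ ℕ.+ ∣ x ℤ.* eval (tabulate tail) x ∣ ≡⟨ cong (∣ h zero ∣ ℕ.+_) (ℤ.abs-* x _) ⟩
  ∣ h zero ∣ ℕ.+ ∣ x ∣ * ∣ eval (tabulate tail) x ∣
    ≤⟨ ℕ.+-monoʳ-≤ ∣ h zero ∣ (ℕ.*-mono-≤ ∣x∣≤H (∣eval-tabulate∣≤ d tail ∣x∣≤H)) ⟩
  ∣ h zero ∣ ℕ.+ H * sum (tabulate weighted)     ≡⟨ cong₂ ℕ._+_ (sym (ℕ.*-identityʳ _)) shift-weights ⟩
  sum (tabulate (λ j → ∣ h j ∣ * H ^ toℕ j))     ∎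
  where
  open ℕ.≤-Reasoning
  tail : Fin d → ℤ
  tail = h ∘ suc
  weighted : Fin d → ℕ
  weighted j = ∣ tail j ∣ * H ^ toℕ j
  shift-weights : H * sum (tabulate weighted) ≡ sum (tabulate (λ j → ∣ tail j ∣ * (H * H ^ toℕ j)))
  shift-weights = begin-equality
    H * sum (tabulate weighted)             ≡⟨ *-distribˡ-sum H (tabulate weighted) ⟩
    sum (map (H *_) (tabulate weighted))    ≡⟨ cong sum (map-tabulate weighted (H *_)) ⟩
    sum (tabulate (λ j → H * weighted j))   ≡⟨ cong sum (tabulate-cong (λ j → x∙yz≈y∙xz H ∣ tail j ∣ (H ^ toℕ j))) ⟩
    sum (tabulate (λ j → ∣ tail j ∣ * (H * H ^ toℕ j))) ∎

∣m-n∣≤o : ∀ {m n o} → n ∸ o ≤ m → m ≤ n ℕ.+ o → ∣ + m ℤ.- + n ∣ ≤ o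
∣m-n∣≤o {m} {n} {o} n∸o≤m m≤n+o with n ℕ.≤? m
... | yes n≤m = begin
  ∣ + m ℤ.- + n ∣ ≡⟨ cong ∣_∣ (ℤ.m-n≡m⊖n m n) ⟩
  ∣ m ℤ.⊖ n ∣     ≡⟨ cong ∣_∣ (ℤ.⊖-≥ n≤m) ⟩
  m ∸ n           ≤⟨ ℕ.m≤n+o⇒m∸n≤o m n m≤n+o ⟩
  o               ∎
  where open ℕ.≤-Reasoning
... | no n≰m = begin
  ∣ + m ℤ.- + n ∣ ≡⟨ cong ∣_∣ (ℤ.m-n≡m⊖n m n) ⟩
  ∣ m ℤ.⊖ n ∣     ≡⟨ ℤ.∣⊖∣-≰ n≰m ⟩
  n ∸ m           ≤⟨ ℕ.m≤n+o⇒m∸n≤o n m n≤m+o ⟩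
  o               ∎
  where
  open ℕ.≤-Reasoning
  n≤m+o : n ≤ m ℕ.+ o
  n≤m+o = ℕ.≤-trans (ℕ.m≤n+m∸n n o) (subst (o ℕ.+ (n ∸ o) ≤_) (ℕ.+-comm o m) (ℕ.+-monoʳ-≤ o n∸o≤m))

m∣n∧n<m⇒n≡0 : ∀ {m n} → m ℕ.∣ n → n < m → n ≡ 0
m∣n∧n<m⇒n≡0 {n = ℕ.zero}  _   _   = refl
m∣n∧n<m⇒n≡0 {n = ℕ.suc _} m∣n n<m = contradiction m∣n (ℕ.>⇒∤ n<m)

k∣i∧∣i∣<∣k∣⇒i≡0 : ∀ {k i} → k ∣ₛ i → ∣ i ∣ < ∣ k ∣ → i ≡ + 0
k∣i∧∣i∣<∣k∣⇒i≡0 k∣i ∣i∣<∣k∣ = ℤ.∣i∣≡0⇒i≡0 (m∣n∧n<m⇒n≡0 (∣⇒∣ᵤ k∣i) ∣i∣<∣k∣)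

^-cancelˡ-< : ∀ n {a b} → a ^ n < b ^ n → a < b
^-cancelˡ-< n aⁿ<bⁿ = ℕ.≰⇒> (λ b≤a → ℕ.<⇒≱ aⁿ<bⁿ (ℕ.^-monoˡ-≤ n b≤a))

proposition2p4 : (N r m d P H : ℕ) → .{{_ : NonZero r}} →
    1 ≤ N → 1 ≤ m → 1 ≤ d → 1 ≤ H →
    2 ^ r ≤ N →
    m * r ≤ d →
    H < P → P ^ r ≤ N →
    H ^ (2 * d * (d ∸ 1)) * d ^ (2 * d) * 2 ^ (d * (d ∸ 1)) * N ^ (2 * r * m * (m ℕ.+ 1))
      < (P ∸ H) ^ (4 * d * r * m) →
    (h : Fin d → ℤ) →
    ¬ (∀ j → h j ≡ + 0) →
    InSpan d (fpoly N r m P) (fromCoeffs d h) →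
    sum (tabulate (λ j → ∣ h j ∣ * H ^ toℕ j)) ^ (4 * d)
      < d ^ (2 * d) * 2 ^ (d * (d ∸ 1)) * H ^ (2 * d * (d ∸ 1)) * N ^ (2 * r * m * (m ℕ.+ 1)) →
    (p : ℤ) → + (P ∸ H) ℤ.≤ p → p ℤ.≤ + (P ℕ.+ H) → (p ℤ.^ r) ∣ + N →
    eval (fromCoeffs d h) (p ℤ.- + P) ≡ + 0
-- Only the two size hypotheses are needed; the others matter for the existence of such an h.
proposition2p4 N r m d P H _ _ _ _ _ _ _ _ growth h _ h∈span small (+ n) (ℤ.+≤+ P∸H≤n) (ℤ.+≤+ n≤P+H) pʳ∣N =
  k∣i∧∣i∣<∣k∣⇒i≡0 pʳᵐ∣h[x₀] (ℕ.≤-<-trans ∣h[x₀]∣≤S (ℕ.<-≤-trans S<[P∸H]ʳᵐ [P∸H]ʳᵐ≤∣pʳᵐ∣))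
  where
  S : ℕ
  S = sum (tabulate (λ j → ∣ h j ∣ * H ^ toℕ j))
  pʳᵐ∣h[x₀] : (+ n) ℤ.^ (r * m) ∣ₛ eval (fromCoeffs d h) (+ n ℤ.- + P)
  pʳᵐ∣h[x₀] = ∣-eval-InSpan d (fpoly N r m P) (fromCoeffs d h) (λ i → ^-∣-eval-fpoly N r m P i (+ n) (∣ᵤ⇒∣ pʳ∣N)) h∈span
  ∣h[x₀]∣≤S : ∣ eval (fromCoeffs d h) (+ n ℤ.- + P) ∣ ≤ S
  ∣h[x₀]∣≤S = ∣eval-tabulate∣≤ d h (∣m-n∣≤o P∸H≤n n≤P+H)
  S<[P∸H]ʳᵐ : S < (P ∸ H) ^ (r * m)
  S<[P∸H]ʳᵐ = ^-cancelˡ-< (4 * d) (begin-strict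
    S ^ (4 * d)                    <⟨ small ⟩
    dᵇ * 2ᶜ * Hᵃ * Nᵉ              ≡⟨ reorder Hᵃ dᵇ 2ᶜ Nᵉ ⟨
    Hᵃ * dᵇ * 2ᶜ * Nᵉ              <⟨ growth ⟩
    (P ∸ H) ^ (4 * d * r * m)      ≡⟨ cong ((P ∸ H) ^_) (regroup d r m) ⟩
    (P ∸ H) ^ (r * m * (4 * d))    ≡⟨ ℕ.^-*-assoc (P ∸ H) (r * m) (4 * d) ⟨
    ((P ∸ H) ^ (r * m)) ^ (4 * d)  ∎)
    where
    open ℕ.≤-Reasoning
    Hᵃ dᵇ 2ᶜ Nᵉ : ℕ
    Hᵃ = H ^ (2 * d * (d ∸ 1))
    dᵇ = d ^ (2 * d)
    2ᶜ = 2 ^ (d * (d ∸ 1))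
    Nᵉ = N ^ (2 * r * m * (m ℕ.+ 1))
    reorder : ∀ a b c e → a * b * c * e ≡ b * c * a * e
    reorder = ℕ-Solver.solve-∀
    regroup : ∀ d r m → 4 * d * r * m ≡ r * m * (4 * d)
    regroup = ℕ-Solver.solve-∀
  [P∸H]ʳᵐ≤∣pʳᵐ∣ : (P ∸ H) ^ (r * m) ≤ ∣ (+ n) ℤ.^ (r * m) ∣
  [P∸H]ʳᵐ≤∣pʳᵐ∣ = subst ((P ∸ H) ^ (r * m) ≤_) (cong ∣_∣ (pos-^ n (r * m))) (ℕ.^-monoˡ-≤ (r * m) P∸H≤n)
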